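{- Let $L$ be a finite graded lattice which is isomorphic to the core of some upho lattice. Then all coefficients of the formal power series $\chi^*(L;x)^{ -1}$ are nonnegative.
   Context: For a finite graded lattice $L$ with rank function $\rho$ and Möbius function $\mu$, $\chi^*(L;x)=\sum_{p\in L}\mu(\hat0,p)x^{\rho(p)}$ (a polynomial with constant term $1$). A poset $\mathcal{P}$ is finite type $\mathbb{N}$-graded if it has a minimum $\hat0$, a rank function $\rho$ with $\rho(\hat0)=0$ such that every maximal chain has the form $\hat0=x_0\lessdot x_1\lessdot\cdots$ with $\rho(x_i)=i$, and finitely many elements of each rank. An upho lattice is a finite type $\mathbb{N}$-graded lattice $\mathcal{L}$ with at least two elements such that every principal filter $\{q\ge p\}$ is isomorphic to $\mathcal{L}$. Its core is $[\hat0,s_1\vee\cdots\vee s_r]$ with $s_i$ the atoms of $\mathcal{L}$. -}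

module Defs where

open import Data.Nat as ℕ using (ℕ; zero; suc; _∸_)
open import Data.Integer as ℤ using (ℤ; 0ℤ; 1ℤ)
open import Data.Fin using (Fin)
open import Data.List using (List; allFin; map; foldr; filter; upTo)
open import Data.List.Membership.Propositional using (_∈_)
open import Data.Product using (Σ; _×_)
open import Data.Sum using (_⊎_)
open import Function.Bundles using (_⇔_)
open import Relation.Binary.PropositionalEquality using (_≡_; _≢_)
open import Relation.Binary.Lattice using (IsLattice)
open import Relation.Binary.Definitions using (Decidable)

Strict : {A : Set} → (A → A → Set) → A → A → Set
Strict _≤_ x y = (x ≤ y) × (x ≢ y)

Covers : {A : Set} → (A → A → Set) → A → A → Set
Covers _≤_ x y =
  Strict _≤_ x y × (∀ z → x ≤ z → z ≤ y → (z ≡ x) ⊎ (z ≡ y))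

IsRankFunction : {A : Set} → (A → A → Set) → A → (A → ℕ) → Set
IsRankFunction _≤_ ⊥ ρ =
  (ρ ⊥ ≡ 0)
  × (∀ x y → Strict _≤_ x y → ρ x ℕ.< ρ y)
  × (∀ x y → Covers _≤_ x y → ρ y ≡ suc (ρ x))

record FiniteGradedLattice (n : ℕ) : Set₁ where
  field
    _≤_       : Fin n → Fin n → Set
    _≤?_      : Decidable _≤_
    _∨_       : Fin n → Fin n → Fin n
    _∧_       : Fin n → Fin n → Fin n
    isLattice : IsLattice _≡_ _≤_ _∨_ _∧_
    ⊥         : Fin n
    ⊥-min     : ∀ x → ⊥ ≤ x
    ρ         : Fin n → ℕ
    isRank    : IsRankFunction _≤_ ⊥ ρ

sumℤ : List ℤ → ℤ
sumℤ = foldr ℤ._+_ 0ℤ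

module _ {n : ℕ} (L : FiniteGradedLattice n) where
  open FiniteGradedLattice L

  -- μ is the Möbius function p ↦ μ(⊥, p) of L:
  -- μ(⊥,⊥) = 1 and Σ_{⊥ ≤ q ≤ p} μ(⊥,q) = 0 for p ≠ ⊥.
  IsMobius : (Fin n → ℤ) → Set
  IsMobius μ =
    (μ ⊥ ≡ 1ℤ)
    × (∀ p → p ≢ ⊥ → sumℤ (map μ (filter (λ q → q ≤? p) (allFin n))) ≡ 0ℤ)

  -- coefficient of x^k in χ*(L;x) = Σ_p μ(⊥,p) x^{ρ(p)}
  chiCoeff : (Fin n → ℤ) → ℕ → ℤ
  chiCoeff μ k = sumℤ (map μ (filter (λ q → ρ q ℕ.≟ k) (allFin n)))

-- Formal power series over ℤ (coefficient sequences ℕ → ℤ)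

conv : (ℕ → ℤ) → (ℕ → ℤ) → ℕ → ℤ
conv a b m = sumℤ (map (λ k → a k ℤ.* b (m ∸ k)) (upTo (suc m)))

one : ℕ → ℤ
one zero    = 1ℤ
one (suc _) = 0ℤ

IsInverse : (ℕ → ℤ) → (ℕ → ℤ) → Set
IsInverse a b = ∀ m → conv a b m ≡ one m

record UphoLattice : Set₁ where
  field
    Carrier    : Set
    _≤_        : Carrier → Carrier → Set
    _∨_        : Carrier → Carrier → Carrier
    _∧_        : Carrier → Carrier → Carrier
    isLattice  : IsLattice _≡_ _≤_ _∨_ _∧_
    ⊥          : Carrier
    ⊥-min      : ∀ x → ⊥ ≤ x
    ρ          : Carrier → ℕ
    isRank     : IsRankFunction _≤_ ⊥ ρ
    finiteType : ∀ k → Σ (List Carrier) (λ xs → ∀ x → (x ∈ xs) ⇔ (ρ x ≡ k))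
    twoElems   : Σ Carrier (λ x → Σ Carrier (λ y → x ≢ y))
    upho       : ∀ p → Σ (Carrier → Carrier) (λ φ →
                   (∀ x → p ≤ φ x)
                   × (∀ y → p ≤ y → Σ Carrier (λ x → φ x ≡ y))
                   × (∀ x y → (x ≤ y) ⇔ (φ x ≤ φ y)))

module _ (U : UphoLattice) where
  open UphoLattice U

  IsAtom : Carrier → Set
  IsAtom a = Covers _≤_ ⊥ a

  IsJoinOfAtoms : Carrier → Set
  IsJoinOfAtoms t =
    (∀ a → IsAtom a → a ≤ t)
    × (∀ u → (∀ a → IsAtom a → a ≤ u) → t ≤ u)

  -- L is isomorphic (as a poset, hence as a lattice) to the core [⊥, t]
  IsoToCore : {n : ℕ} → FiniteGradedLattice n → Carrier → Set
  IsoToCore {n} L t = Σ (Fin n → Carrier) (λ f →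
      (∀ x → f x ≤ t)
      × (∀ y → y ≤ t → Σ (Fin n) (λ x → f x ≡ y))
      × (∀ x y → FiniteGradedLattice._≤_ L x y ⇔ (f x ≤ f y)))

{-# OPTIONS --safe #-}

-- Let F(x) = Σₖ #{q ∈ 𝓛 : ρ q = k} xᵏ be the rank generating function of the upho lattice 𝓛
-- and f : L ≅ [⊥, t] its core. Then χ*(L;x) · F(x) = 1, so the coefficients of χ*(L;x)⁻¹ are
-- the counts #{ρ q = k} ≥ 0. The coefficient of xᵐ in the product is
-- Σ_{p ∈ L} μ(⊥,p) · #{q : ρ q = m, f p ≤ q}, because the filter above f p is a copy of 𝓛
-- shifted by ρ(p) in rank (its isomorphism carries saturated chains from ⊥ to saturated chains
-- from f p). Exchanging the sums, each q of rank m contributes Σ_{p ≤ q ∧ t} μ(⊥,p), which is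
-- [q ∧ t = ⊥]; and q ∧ t = ⊥ only for q = ⊥, since any q ≠ ⊥ lies above an atom and every atom
-- lies below t.
--
-- Nothing makes the order of 𝓛 decidable, but the coefficients up to xᵏ only involve the
-- finitely many elements of rank ≤ k, on which decidability holds up to double negation. That
-- suffices, because the goal 0 ≤ bₖ is itself decidable.

module Submission where

open import Level using (0ℓ)
open import Function using (_∘_)
open import Function.Bundles using (_⇔_; mk⇔; Equivalence)
open import Data.Empty using (⊥-elim)
open import Data.Product using (∃; _×_; _,_; proj₁; proj₂; uncurry)
open import Data.Sum as Sum using (_⊎_; inj₁; inj₂)
open import Data.Nat as ℕ using (ℕ; zero; suc; _∸_; z≤n; s≤s)
import Data.Nat.Properties as ℕP
open import Data.Nat.Induction using (<-rec; <-wellFounded)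
open import Data.Integer as ℤ using (ℤ; 0ℤ; 1ℤ; +_; +≤+; _+_; _*_)
import Data.Integer.Properties as ℤP
open import Data.Fin as Fin using (Fin)
open import Data.List
  using (List; []; _∷_; _++_; map; filter; length; upTo; applyUpTo; allFin; concatMap)
open import Data.List.Properties using (map-cong-local; length-++; length-map)
open import Data.List.Membership.Propositional using (_∈_; lose)
open import Data.List.Membership.Propositional.Properties
  using (∈-∃++; ∈-++⁺ˡ; ∈-++⁺ʳ; ∈-++⁻; ∈-map⁺; ∈-map⁻; ∈-filter⁺; ∈-filter⁻; ∈-upTo⁺; ∈-upTo⁻;
         ∈-applyUpTo⁻; ∈-concat⁺′; ∈-allFin)
open import Data.List.Relation.Binary.Subset.Propositional using (_⊆_)
open import Data.List.Relation.Unary.Any using (Any; here; there; any?; satisfied; fromSum; toSum)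
import Data.List.Relation.Unary.All as All
open import Data.List.Relation.Unary.AllPairs using ([]; _∷_)
open import Data.List.Relation.Unary.Unique.Propositional using (Unique)
import Data.List.Relation.Unary.Unique.Propositional.Properties as Unique
open import Induction.WellFounded using (Acc; acc)
open import Relation.Nullary using (Dec; yes; no; ¬_)
open import Relation.Nullary.Negation using (¬¬-map; ¬¬-Monad)
import Relation.Nullary.Decidable as Dec
open import Relation.Nullary.Decidable
  using (_⊎-dec_; _×-dec_; ¬?; decidable-stable; ¬¬-excluded-middle)
open import Relation.Unary using (Pred; Decidable)
open import Relation.Binary.Structures using (IsPartialOrder)
open import Relation.Binary.Lattice using (IsLattice)
open import Relation.Binary.PropositionalEquality
  using (_≡_; _≢_; refl; sym; trans; cong; cong₂; subst; subst₂; module ≡-Reasoning)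
import Algebra.Properties.CommutativeSemigroup ℤP.+-commutativeSemigroup as +-Comm
import Algebra.Properties.CommutativeSemigroup ℤP.*-commutativeSemigroup as *-Comm
open import Algebra.Properties.AbelianGroup ℤP.+-0-abelianGroup using (∙-cancelʳ)

open import Defs

𝟙 : {P : Set} → Dec P → ℤ
𝟙 (yes _) = 1ℤ
𝟙 (no _)  = 0ℤ

module _ {A : Set} where

  ∑ : List A → (A → ℤ) → ℤ
  ∑ xs g = sumℤ (map g xs)

  ∑-cong : ∀ xs {g h : A → ℤ} → (∀ {x} → x ∈ xs → g x ≡ h x) → ∑ xs g ≡ ∑ xs h
  ∑-cong xs g≡h = cong sumℤ (map-cong-local (All.tabulate g≡h))

  ∑-zero : ∀ xs {g : A → ℤ} → (∀ {x} → x ∈ xs → g x ≡ 0ℤ) → ∑ xs g ≡ 0ℤ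
  ∑-zero []       g≡0 = refl
  ∑-zero (x ∷ xs) g≡0 = cong₂ _+_ (g≡0 (here refl)) (∑-zero xs (g≡0 ∘ there))

  ∑-+ : ∀ xs (g h : A → ℤ) → ∑ xs (λ x → g x + h x) ≡ ∑ xs g + ∑ xs h
  ∑-+ []       g h = refl
  ∑-+ (x ∷ xs) g h = trans (cong (λ s → g x + h x + s) (∑-+ xs g h))
                           (+-Comm.interchange (g x) (h x) (∑ xs g) (∑ xs h))

  ∑-*ʳ : ∀ xs (g : A → ℤ) c → ∑ xs (λ x → g x * c) ≡ ∑ xs g * c
  ∑-*ʳ []       g c = sym (ℤP.*-zeroˡ c)
  ∑-*ʳ (x ∷ xs) g c = trans (cong (λ s → g x * c + s) (∑-*ʳ xs g c))
                            (sym (ℤP.*-distribʳ-+ c (g x) (∑ xs g)))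

  ∑-filter : ∀ {P : Pred A 0ℓ} (P? : Decidable P) xs (g : A → ℤ) →
             ∑ (filter P? xs) g ≡ ∑ xs (λ x → 𝟙 (P? x) * g x)
  ∑-filter P? []       g = refl
  ∑-filter P? (x ∷ xs) g with P? x
  ... | yes _ = cong₂ _+_ (sym (ℤP.*-identityˡ (g x))) (∑-filter P? xs g)
  ... | no  _ = trans (∑-filter P? xs g) (sym (ℤP.+-identityˡ _))

  ∑-𝟙 : ∀ {P : Pred A 0ℓ} (P? : Decidable P) xs → ∑ xs (𝟙 ∘ P?) ≡ + length (filter P? xs)
  ∑-𝟙 P? []       = refl
  ∑-𝟙 P? (x ∷ xs) with P? x
  ... | yes _ = cong (λ s → 1ℤ + s) (∑-𝟙 P? xs)
  ... | no  _ = trans (ℤP.+-identityˡ _) (∑-𝟙 P? xs)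

module _ {A B : Set} where

  ∑-swap : ∀ (xs : List A) (ys : List B) (h : A → B → ℤ) →
           ∑ xs (λ x → ∑ ys (h x)) ≡ ∑ ys (λ y → ∑ xs (λ x → h x y))
  ∑-swap []       ys h = sym (∑-zero ys (λ _ → refl))
  ∑-swap (x ∷ xs) ys h = trans (cong (λ s → ∑ ys (h x) + s) (∑-swap xs ys h))
                               (sym (∑-+ ys (h x) (λ y → ∑ xs (λ x′ → h x′ y))))

module _ {A : Set} where

  unique-⊆⇒length≤ : ∀ {xs ys : List A} → Unique xs → xs ⊆ ys → length xs ℕ.≤ length ys
  unique-⊆⇒length≤ {[]}              _          _     = z≤n
  unique-⊆⇒length≤ {x ∷ xs} {ys} (x∉xs ∷ !xs) xs⊆ys
    with ys₁ , ys₂ , refl ← ∈-∃++ (xs⊆ys (here refl)) =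
    subst (suc (length xs) ℕ.≤_) (sym length-with-x)
          (s≤s (unique-⊆⇒length≤ !xs xs⊆ys₁ys₂))
    where
    length-with-x : length (ys₁ ++ x ∷ ys₂) ≡ suc (length (ys₁ ++ ys₂))
    length-with-x rewrite length-++ ys₁ {x ∷ ys₂} | length-++ ys₁ {ys₂} =
      ℕP.+-suc (length ys₁) (length ys₂)
    xs⊆ys₁ys₂ : xs ⊆ ys₁ ++ ys₂
    xs⊆ys₁ys₂ {z} z∈xs with ∈-++⁻ ys₁ (xs⊆ys (there z∈xs))
    ... | inj₁ z∈ys₁         = ∈-++⁺ˡ z∈ys₁
    ... | inj₂ (here refl)   = ⊥-elim (All.lookup x∉xs z∈xs refl)
    ... | inj₂ (there z∈ys₂) = ∈-++⁺ʳ ys₁ z∈ys₂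

  unique-⊆⊇⇒length≡ : ∀ {xs ys : List A} → Unique xs → Unique ys → xs ⊆ ys → ys ⊆ xs →
                      length xs ≡ length ys
  unique-⊆⊇⇒length≡ !xs !ys xs⊆ys ys⊆xs =
    ℕP.≤-antisym (unique-⊆⇒length≤ !xs xs⊆ys) (unique-⊆⇒length≤ !ys ys⊆xs)

  ∈?-on : ∀ {x : A} ys → (∀ {y} → y ∈ ys → Dec (x ≡ y)) → Dec (x ∈ ys)
  ∈?-on     []       _   = no λ ()
  ∈?-on {x} (y ∷ ys) x≟_ = Dec.map′ fromSum toSum (x≟ here refl ⊎-dec ∈?-on {x} ys (x≟_ ∘ there))

  deduplicate-on : ∀ xs → (∀ {x y} → x ∈ xs → y ∈ xs → Dec (x ≡ y)) →
                   ∃ λ ys → Unique ys × ys ⊆ xs × xs ⊆ ys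
  deduplicate-on []       _   = [] , [] , (λ ()) , (λ ())
  deduplicate-on (x ∷ xs) _≟_
    with deduplicate-on xs (λ y∈xs z∈xs → there y∈xs ≟ there z∈xs)
       | ∈?-on xs (λ y∈xs → here refl ≟ there y∈xs)
  ... | ys , !ys , ys⊆xs , xs⊆ys | yes x∈xs =
    ys , !ys , there ∘ ys⊆xs , λ { (here refl) → xs⊆ys x∈xs ; (there z∈xs) → xs⊆ys z∈xs }
  ... | ys , !ys , ys⊆xs , xs⊆ys | no x∉xs =
    x ∷ ys , All.tabulate (λ { y∈ys refl → x∉xs (ys⊆xs y∈ys) }) ∷ !ys ,
    (λ { (here refl) → here refl ; (there z∈ys) → there (ys⊆xs z∈ys) }) ,
    (λ { (here refl) → here refl ; (there z∈xs) → there (xs⊆ys z∈xs) })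

module _ {A B : Set} {P : Pred A 0ℓ} (P? : Decidable P) where

  count-by-bijection : ∀ {xs : List A} {ys : List B} (g : B → A) →
    Unique xs → Unique ys → (∀ {y y′} → g y ≡ g y′ → y ≡ y′) →
    (∀ {y} → y ∈ ys → g y ∈ xs × P (g y)) →
    (∀ {x} → x ∈ xs → P x → ∃ λ y → y ∈ ys × g y ≡ x) →
    ∑ xs (𝟙 ∘ P?) ≡ + length ys
  count-by-bijection {xs} {ys} g !xs !ys g-inj into onto = begin
    ∑ xs (𝟙 ∘ P?)               ≡⟨ ∑-𝟙 P? xs ⟩
    + length (filter P? xs)     ≡⟨ cong +_ (unique-⊆⊇⇒length≡ (Unique.filter⁺ P? !xs)
                                     (Unique.map⁺ g-inj !ys) filtered⊆image image⊆filtered) ⟩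
    + length (map g ys)         ≡⟨ cong +_ (length-map g ys) ⟩
    + length ys                 ∎
    where
    open ≡-Reasoning
    filtered⊆image : filter P? xs ⊆ map g ys
    filtered⊆image x∈ with x∈xs , px ← ∈-filter⁻ P? x∈
                       with y , y∈ys , refl ← onto x∈xs px = ∈-map⁺ g y∈ys
    image⊆filtered : map g ys ⊆ filter P? xs
    image⊆filtered x∈ with y , y∈ys , refl ← ∈-map⁻ g x∈ = uncurry (∈-filter⁺ P?) (into y∈ys)

module _ {A : Set} {P : Pred A 0ℓ} (P? : Decidable P) where

  ∑-δ : ∀ {xs} {a} (h : A → ℤ) → Unique xs → a ∈ xs → P a → (∀ {x} → P x → x ≡ a) →
        ∑ xs (λ x → 𝟙 (P? x) * h x) ≡ h a
  ∑-δ {xs} {a} h !xs a∈xs pa only-a = begin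
    ∑ xs (λ x → 𝟙 (P? x) * h x)   ≡⟨ ∑-cong xs (λ {x} _ → at-a x) ⟩
    ∑ xs (λ x → 𝟙 (P? x) * h a)   ≡⟨ ∑-*ʳ xs (𝟙 ∘ P?) (h a) ⟩
    ∑ xs (𝟙 ∘ P?) * h a           ≡⟨ cong (_* h a) (count-by-bijection P? (λ x → x) !xs
                                       (All.[] ∷ []) (λ x≡y → x≡y) (λ { (here refl) → a∈xs , pa })
                                       (λ _ px → a , here refl , sym (only-a px))) ⟩
    1ℤ * h a                      ≡⟨ ℤP.*-identityˡ (h a) ⟩
    h a                           ∎
    where
    open ≡-Reasoning
    at-a : ∀ x → 𝟙 (P? x) * h x ≡ 𝟙 (P? x) * h a
    at-a x with P? x
    ... | yes px = cong (λ y → 1ℤ * h y) (only-a px)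
    ... | no  _  = refl

monomial : ℕ → ℕ → ℤ
monomial r j = 𝟙 (r ℕ.≟ j)

conv-congˡ : ∀ {a a′ : ℕ → ℤ} (c : ℕ → ℤ) → (∀ j → a j ≡ a′ j) → ∀ m → conv a c m ≡ conv a′ c m
conv-congˡ c a≡a′ m = ∑-cong (upTo (suc m)) (λ {k} _ → cong (_* c (m ∸ k)) (a≡a′ k))

conv-∑ˡ : ∀ {I : Set} (is : List I) (e : I → ℕ → ℤ) (w : I → ℤ) (c : ℕ → ℤ) m →
          conv (λ j → ∑ is (λ i → e i j * w i)) c m ≡ ∑ is (λ i → conv (e i) c m * w i)
conv-∑ˡ is e w c m = begin
  ∑ ks (λ k → ∑ is (λ i → e i k * w i) * c (m ∸ k))
    ≡⟨ ∑-cong ks (λ {k} _ → sym (∑-*ʳ is (λ i → e i k * w i) (c (m ∸ k)))) ⟩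
  ∑ ks (λ k → ∑ is (λ i → e i k * w i * c (m ∸ k)))
    ≡⟨ ∑-cong ks (λ {k} _ → ∑-cong is (λ {i} _ → *-Comm.xy∙z≈xz∙y (e i k) (w i) (c (m ∸ k)))) ⟩
  ∑ ks (λ k → ∑ is (λ i → e i k * c (m ∸ k) * w i))
    ≡⟨ ∑-swap ks is (λ k i → e i k * c (m ∸ k) * w i) ⟩
  ∑ is (λ i → ∑ ks (λ k → e i k * c (m ∸ k) * w i))
    ≡⟨ ∑-cong is (λ {i} _ → ∑-*ʳ ks (λ k → e i k * c (m ∸ k)) (w i)) ⟩
  ∑ is (λ i → conv (e i) c m * w i) ∎
  where
  open ≡-Reasoning
  ks = upTo (suc m)

module _ {r m : ℕ} (c : ℕ → ℤ) where

  conv-monomial-≤ : r ℕ.≤ m → conv (monomial r) c m ≡ c (m ∸ r)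
  conv-monomial-≤ r≤m = ∑-δ (r ℕ.≟_) (λ j → c (m ∸ j)) (Unique.upTo⁺ (suc m))
                          (∈-upTo⁺ (s≤s r≤m)) refl sym

  conv-monomial-> : m ℕ.< r → conv (monomial r) c m ≡ 0ℤ
  conv-monomial-> m<r = ∑-zero (upTo (suc m)) vanish
    where
    vanish : ∀ {j} → j ∈ upTo (suc m) → monomial r j * c (m ∸ j) ≡ 0ℤ
    vanish {j} j∈ with r ℕ.≟ j
    ... | yes refl = ⊥-elim (ℕP.<⇒≱ m<r (ℕP.≤-pred (∈-upTo⁻ j∈)))
    ... | no  _    = refl

conv-cancelˡ : ∀ {a b c : ℕ → ℤ} {K} → a 0 ≡ 1ℤ →
               (∀ m → m ℕ.≤ K → conv a b m ≡ conv a c m) → ∀ m → m ℕ.≤ K → b m ≡ c m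
conv-cancelˡ {a} {b} {c} {K} a₀≡1 ab≡ac = <-rec _ step
  where
  higher : (ℕ → ℤ) → ℕ → ℤ
  higher d m = ∑ (applyUpTo suc m) (λ k → a k * d (m ∸ k))

  step : ∀ m → (∀ {j} → j ℕ.< m → j ℕ.≤ K → b j ≡ c j) → m ℕ.≤ K → b m ≡ c m
  step m ih m≤K = begin
    b m                ≡⟨ sym (ℤP.*-identityˡ (b m)) ⟩
    1ℤ * b m           ≡⟨ cong (_* b m) (sym a₀≡1) ⟩
    a 0 * b m          ≡⟨ ∙-cancelʳ (higher b m) (a 0 * b m) (a 0 * c m) leading≡ ⟩
    a 0 * c m          ≡⟨ cong (_* c m) a₀≡1 ⟩
    1ℤ * c m           ≡⟨ ℤP.*-identityˡ (c m) ⟩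
    c m                ∎
    where
    open ≡-Reasoning
    higher≡ : higher b m ≡ higher c m
    higher≡ = ∑-cong (applyUpTo suc m) λ k∈ → case-suc (∈-applyUpTo⁻ suc k∈)
      where
      case-suc : ∀ {k} → ∃ (λ i → i ℕ.< m × k ≡ suc i) → a k * b (m ∸ k) ≡ a k * c (m ∸ k)
      case-suc (i , i<m , refl) = cong (a (suc i) *_)
        (ih (ℕP.∸-monoʳ-< (s≤s z≤n) i<m) (ℕP.≤-trans (ℕP.m∸n≤m m (suc i)) m≤K))
    leading≡ : a 0 * b m + higher b m ≡ a 0 * c m + higher b m
    leading≡ = begin
      a 0 * b m + higher b m ≡⟨ ab≡ac m m≤K ⟩
      a 0 * c m + higher c m ≡⟨ cong (λ s → a 0 * c m + s) (sym higher≡) ⟩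
      a 0 * c m + higher b m ∎

module _ {A : Set} (_≤_ : A → A → Set) where

  data SaturatedChain : A → A → ℕ → Set where
    []  : ∀ {a} → SaturatedChain a a 0
    _∷_ : ∀ {a b x r} → Covers _≤_ a b → SaturatedChain b x r → SaturatedChain a x (suc r)

module _ {A : Set} {_≤_ : A → A → Set} where

  _++ᶜ_ : ∀ {a w x r s} → SaturatedChain _≤_ a w r → SaturatedChain _≤_ w x s →
          SaturatedChain _≤_ a x (r ℕ.+ s)
  []       ++ᶜ ds = ds
  (c ∷ cs) ++ᶜ ds = c ∷ (cs ++ᶜ ds)

module RankedPoset {A : Set} {_≤_ : A → A → Set} (isPartialOrder : IsPartialOrder _≡_ _≤_)
                   {⊥ : A} {ρ : A → ℕ} (isRank : IsRankFunction _≤_ ⊥ ρ) where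

  open IsPartialOrder isPartialOrder using (antisym) renaming (refl to ≤-refl; trans to ≤-trans)

  ρ-strict : ∀ {x y} → x ≤ y → x ≢ y → ρ x ℕ.< ρ y
  ρ-strict x≤y x≢y = proj₁ (proj₂ isRank) _ _ (x≤y , x≢y)

  ρ-< : ∀ {x y} → x ≤ y → ¬ y ≤ x → ρ x ℕ.< ρ y
  ρ-< x≤y y≰x = ρ-strict x≤y λ { refl → y≰x ≤-refl }

  ρ-mono : ∀ {x y} → x ≤ y → ρ x ℕ.≤ ρ y
  ρ-mono {x} {y} x≤y = decidable-stable (ρ x ℕ.≤? ρ y) λ ρx≰ρy →
    ρx≰ρy (ℕP.<⇒≤ (ρ-strict x≤y λ { refl → ρx≰ρy ℕP.≤-refl }))

  ρ-cover : ∀ {x y} → Covers _≤_ x y → ρ y ≡ suc (ρ x)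
  ρ-cover = proj₂ (proj₂ isRank) _ _

  chain-rank : ∀ {a x r} → SaturatedChain _≤_ a x r → ρ x ≡ ρ a ℕ.+ r
  chain-rank {a} []                 = sym (ℕP.+-identityʳ (ρ a))
  chain-rank {a} {r = suc r} (a⋖b ∷ bs) = begin
    _                 ≡⟨ chain-rank bs ⟩
    _ ℕ.+ r           ≡⟨ cong (ℕ._+ r) (ρ-cover a⋖b) ⟩
    suc (ρ a ℕ.+ r)   ≡⟨ ℕP.+-suc (ρ a) r ⟨
    ρ a ℕ.+ suc r     ∎
    where open ≡-Reasoning

  ρ⊥≡0 : ρ ⊥ ≡ 0
  ρ⊥≡0 = proj₁ isRank

  ρ-from-⊥ : ∀ {x r} → SaturatedChain _≤_ ⊥ x r → ρ x ≡ r
  ρ-from-⊥ {r = r} chain = trans (chain-rank chain) (cong (ℕ._+ r) ρ⊥≡0)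

  chain-≤ : ∀ {a x r} → SaturatedChain _≤_ a x r → a ≤ x
  chain-≤ []                       = ≤-refl
  chain-≤ (((a≤b , _) , _) ∷ bs) = ≤-trans a≤b (chain-≤ bs)

  module SaturatedChains (K : ℕ) (_≤?_ : ∀ x y → ρ y ℕ.≤ K → Dec (x ≤ y))
                         (elems : List A) (elems-complete : ∀ {x} → ρ x ℕ.≤ K → x ∈ elems) where

    ρ≤K-down : ∀ {x y} → x ≤ y → ρ y ℕ.≤ K → ρ x ℕ.≤ K
    ρ≤K-down x≤y = ℕP.≤-trans (ρ-mono x≤y)

    StrictlyBetween : A → A → A → Set
    StrictlyBetween a x w = w ≤ x × a ≤ w × ¬ w ≤ a × ¬ x ≤ w

    between? : ∀ {a x} → a ≤ x → ρ x ℕ.≤ K → Decidable (StrictlyBetween a x)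
    between? {a} {x} a≤x ρx≤K w with (w ≤? x) ρx≤K
    ... | no  w≰x = no (w≰x ∘ proj₁)
    ... | yes w≤x = Dec.map′ (w≤x ,_) proj₂
      ((a ≤? w) ρw≤K ×-dec ¬? ((w ≤? a) (ρ≤K-down a≤x ρx≤K)) ×-dec ¬? ((x ≤? w) ρw≤K))
      where ρw≤K = ρ≤K-down w≤x ρx≤K

    covers-if-nothing-between : ∀ {a x} → a ≤ x → ¬ x ≤ a → ρ x ℕ.≤ K →
                                ¬ Any (StrictlyBetween a x) elems → Covers _≤_ a x
    covers-if-nothing-between {a} {x} a≤x x≰a ρx≤K none =
      (a≤x , λ { refl → x≰a ≤-refl }) , only-ends
      where
      only-ends : ∀ z → a ≤ z → z ≤ x → z ≡ a ⊎ z ≡ x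
      only-ends z a≤z z≤x with (z ≤? a) (ρ≤K-down a≤x ρx≤K) | (x ≤? z) (ρ≤K-down z≤x ρx≤K)
      ... | yes z≤a | _       = inj₁ (antisym z≤a a≤z)
      ... | no  _   | yes x≤z = inj₂ (antisym z≤x x≤z)
      ... | no  z≰a | no  x≰z =
        ⊥-elim (none (lose (elems-complete (ρ≤K-down z≤x ρx≤K)) (z≤x , a≤z , z≰a , x≰z)))

    saturatedChain : ∀ {a x} → a ≤ x → ρ x ℕ.≤ K → ∃ (SaturatedChain _≤_ a x)
    saturatedChain = go (<-wellFounded _)
      where
      go : ∀ {a x} → Acc ℕ._<_ (ρ x ∸ ρ a) → a ≤ x → ρ x ℕ.≤ K → ∃ (SaturatedChain _≤_ a x)
      go {a} {x} (acc smaller) a≤x ρx≤K with (x ≤? a) (ρ≤K-down a≤x ρx≤K)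
      ... | yes x≤a with refl ← antisym a≤x x≤a = 0 , []
      ... | no  x≰a with any? (between? a≤x ρx≤K) elems
      ...   | no  none  = 1 , covers-if-nothing-between a≤x x≰a ρx≤K none ∷ []
      ...   | yes found with w , w≤x , a≤w , w≰a , x≰w ← satisfied found =
        let r , a→w = go (smaller (ℕP.∸-monoˡ-< (ρ-< w≤x x≰w) (ρ-mono a≤w)))
                         a≤w (ρ≤K-down w≤x ρx≤K)
            s , w→x = go (smaller (ℕP.∸-monoʳ-< (ρ-< a≤w w≰a) (ρ-mono w≤x))) w≤x ρx≤K
        in r ℕ.+ s , a→w ++ᶜ w→x

module OrderEmbedding {A B : Set} {_≤ᴬ_ : A → A → Set} {_≤ᴮ_ : B → B → Set}
         (posetᴬ : IsPartialOrder _≡_ _≤ᴬ_) (posetᴮ : IsPartialOrder _≡_ _≤ᴮ_)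
         (g : A → B) (embedding : ∀ x y → x ≤ᴬ y ⇔ g x ≤ᴮ g y) where

  private
    module Aᴾ = IsPartialOrder posetᴬ
    module Bᴾ = IsPartialOrder posetᴮ

  mono : ∀ {x y} → x ≤ᴬ y → g x ≤ᴮ g y
  mono = Equivalence.to (embedding _ _)

  cancel : ∀ {x y} → g x ≤ᴮ g y → x ≤ᴬ y
  cancel = Equivalence.from (embedding _ _)

  injective : ∀ {x y} → g x ≡ g y → x ≡ y
  injective gx≡gy = Aᴾ.antisym (cancel (Bᴾ.reflexive gx≡gy)) (cancel (Bᴾ.reflexive (sym gx≡gy)))

  ⊥↦min : ∀ {⊥ b} → (∀ x → ⊥ ≤ᴬ x) → (∀ x → b ≤ᴮ g x) → (∃ λ w → g w ≡ b) → g ⊥ ≡ b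
  ⊥↦min ⊥-min b≤ (w , refl) = Bᴾ.antisym (mono (⊥-min w)) (b≤ _)

  reflects-covers : ∀ {x y} → Covers _≤ᴮ_ (g x) (g y) → Covers _≤ᴬ_ x y
  reflects-covers ((gx≤gy , gx≢gy) , only-ends) =
    (cancel gx≤gy , gx≢gy ∘ cong g) , λ z x≤z z≤y →
      Sum.map injective injective (only-ends (g z) (mono x≤z) (mono z≤y))

  module _ (convex : ∀ {x y z} → g x ≤ᴮ z → z ≤ᴮ g y → ∃ λ w → g w ≡ z) where

    preserves-covers : ∀ {x y} → Covers _≤ᴬ_ x y → Covers _≤ᴮ_ (g x) (g y)
    preserves-covers {x} {y} ((x≤y , x≢y) , only-ends) = (mono x≤y , x≢y ∘ injective) , only-ends′
      where
      only-ends′ : ∀ z → g x ≤ᴮ z → z ≤ᴮ g y → z ≡ g x ⊎ z ≡ g y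
      only-ends′ z gx≤z z≤gy with w , refl ← convex gx≤z z≤gy =
        Sum.map (cong g) (cong g) (only-ends w (cancel gx≤z) (cancel z≤gy))

    map-chain : ∀ {a x r} → SaturatedChain _≤ᴬ_ a x r → SaturatedChain _≤ᴮ_ (g a) (g x) r
    map-chain []       = []
    map-chain (c ∷ cs) = preserves-covers c ∷ map-chain cs

  module _ (up-closed : ∀ {x z} → g x ≤ᴮ z → ∃ λ w → g w ≡ z) where

    unmap-chain : ∀ {a z r} → SaturatedChain _≤ᴮ_ (g a) z r →
                  ∃ λ x → g x ≡ z × SaturatedChain _≤ᴬ_ a x r
    unmap-chain []       = _ , refl , []
    unmap-chain (c ∷ cs) with w , refl ← up-closed (proj₁ (proj₁ c))
                         with x , refl , ds ← unmap-chain cs =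
      x , refl , reflects-covers c ∷ ds

¬¬-decidableOn : ∀ {A : Set} (xs : List A) (R : A → A → Set) →
                 ¬ ¬ (∀ {x y} → x ∈ xs → y ∈ xs → Dec (R x y))
¬¬-decidableOn {A} xs R = ¬¬-map (λ table {x} {y} x∈ y∈ → All.lookup (All.lookup table x∈) y∈)
                                 (¬¬-All λ x → ¬¬-All λ y → ¬¬-excluded-middle)
  where
  ¬¬-All : ∀ {P : A → Set} → (∀ x → ¬ ¬ P x) → ¬ ¬ All.All P xs
  ¬¬-All ¬¬p = All.sequenceM _ ¬¬-Monad (All.tabulate λ {x} _ → ¬¬p x)

module Upho (U : UphoLattice) where

  open UphoLattice U public
  open IsLattice isLattice public
    using (isPartialOrder; antisym; x∧y≤x; x∧y≤y; ∧-greatest)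
    renaming (refl to ≤-refl; trans to ≤-trans)
  open RankedPoset isPartialOrder isRank public

  DecidableUpToRank : ℕ → Set
  DecidableUpToRank K = ∀ x y → ρ y ℕ.≤ K → Dec (x ≤ y)

  rank-level : ℕ → List Carrier
  rank-level j = proj₁ (finiteType j)

  ∈-rank-level : ∀ {x j} → x ∈ rank-level j ⇔ ρ x ≡ j
  ∈-rank-level = proj₂ (finiteType _) _

  up-to-rank : ℕ → List Carrier
  up-to-rank K = concatMap rank-level (upTo (suc K))

  ∈-up-to-rank : ∀ {x K} → ρ x ℕ.≤ K → x ∈ up-to-rank K
  ∈-up-to-rank ρx≤K = ∈-concat⁺′ (Equivalence.from ∈-rank-level refl)
                                 (∈-map⁺ rank-level (∈-upTo⁺ (s≤s ρx≤K)))

  ¬¬-decidableUpToRank : ∀ K → ¬ ¬ DecidableUpToRank K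
  ¬¬-decidableUpToRank K = ¬¬-map decide (¬¬-decidableOn (up-to-rank K) _≤_)
    where
    decide : (∀ {x y} → x ∈ up-to-rank K → y ∈ up-to-rank K → Dec (x ≤ y)) → DecidableUpToRank K
    decide _≤?_ x y ρy≤K with ρ x ℕ.≤? ρ y
    ... | yes ρx≤ρy = ∈-up-to-rank (ℕP.≤-trans ρx≤ρy ρy≤K) ≤? ∈-up-to-rank ρy≤K
    ... | no  ρx≰ρy = no (ρx≰ρy ∘ ρ-mono)

  module UpToRank (K : ℕ) (_≤?_ : DecidableUpToRank K) where

    open SaturatedChains K _≤?_ (up-to-rank K) ∈-up-to-rank public

    ≡-decidable : ∀ {x y} → ρ x ℕ.≤ K → ρ y ℕ.≤ K → Dec (x ≡ y)
    ≡-decidable {x} {y} ρx≤K ρy≤K = Dec.map′ (uncurry antisym) (λ { refl → ≤-refl , ≤-refl })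
                                              ((x ≤? y) ρy≤K ×-dec (y ≤? x) ρx≤K)

    IsRankLevel : ℕ → List Carrier → Set
    IsRankLevel j qs = Unique qs × (∀ q → q ∈ qs ⇔ ρ q ≡ j)

    rankLevel : ∀ j → j ℕ.≤ K → ∃ (IsRankLevel j)
    rankLevel j j≤K = level (deduplicate-on (rank-level j) _≟_)
      where
      ρ≤K : ∀ {x} → x ∈ rank-level j → ρ x ℕ.≤ K
      ρ≤K x∈ = subst (ℕ._≤ K) (sym (Equivalence.to ∈-rank-level x∈)) j≤K
      _≟_ : ∀ {x y} → x ∈ rank-level j → y ∈ rank-level j → Dec (x ≡ y)
      x∈ ≟ y∈ = ≡-decidable (ρ≤K x∈) (ρ≤K y∈)
      level : (∃ λ qs → Unique qs × qs ⊆ rank-level j × rank-level j ⊆ qs) → ∃ (IsRankLevel j)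
      level (qs , !qs , qs⊆ , ⊆qs) =
        qs , !qs , λ q → mk⇔ (Equivalence.to ∈-rank-level ∘ qs⊆)
                             (⊆qs ∘ Equivalence.from ∈-rank-level)

    level-ρ≤K : ∀ {m qs q} → m ℕ.≤ K → IsRankLevel m qs → q ∈ qs → ρ q ℕ.≤ K
    level-ρ≤K {q = q} m≤K (_ , ∈qs) q∈ = subst (ℕ._≤ K) (sym (Equivalence.to (∈qs q) q∈)) m≤K

    -- The value 0 above K is junk: rank levels are only available up to K.
    rankCount : ℕ → ℕ
    rankCount j with j ℕ.≤? K
    ... | yes j≤K = length (proj₁ (rankLevel j j≤K))
    ... | no  _   = 0

    rankCount-level : ∀ {j} → j ℕ.≤ K → ∃ λ qs → IsRankLevel j qs × rankCount j ≡ length qs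
    rankCount-level {j} j≤K with j ℕ.≤? K
    ... | yes j≤K′ = proj₁ (rankLevel j j≤K′) , proj₂ (rankLevel j j≤K′) , refl
    ... | no  j≰K  = ⊥-elim (j≰K j≤K)

    module Filter (p : Carrier) where

      φ : Carrier → Carrier
      φ = proj₁ (upho p)

      φ-embedding : ∀ x y → x ≤ y ⇔ φ x ≤ φ y
      φ-embedding = proj₂ (proj₂ (proj₂ (upho p)))

      p≤φ : ∀ x → p ≤ φ x
      p≤φ = proj₁ (proj₂ (upho p))

      φ-onto : ∀ y → p ≤ y → ∃ λ x → φ x ≡ y
      φ-onto = proj₁ (proj₂ (proj₂ (upho p)))

      φ-up-closed : ∀ {x z} → φ x ≤ z → ∃ λ w → φ w ≡ z
      φ-up-closed {x} {z} φx≤z = φ-onto z (≤-trans (p≤φ x) φx≤z)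

      module Φ = OrderEmbedding isPartialOrder isPartialOrder φ φ-embedding

      φ⊥≡p : φ ⊥ ≡ p
      φ⊥≡p = Φ.⊥↦min ⊥-min p≤φ (φ-onto p ≤-refl)

      ρ-φ : ∀ {x} → ρ x ℕ.≤ K → ρ (φ x) ≡ ρ p ℕ.+ ρ x
      ρ-φ {x} ρx≤K with r , chain ← saturatedChain (⊥-min x) ρx≤K = begin
        ρ (φ x)       ≡⟨ chain-rank (Φ.map-chain (λ φx≤z _ → φ-up-closed φx≤z) chain) ⟩
        ρ (φ ⊥) ℕ.+ r ≡⟨ cong₂ ℕ._+_ (cong ρ φ⊥≡p) (sym (ρ-from-⊥ chain)) ⟩
        ρ p ℕ.+ ρ x   ∎
        where open ≡-Reasoning

      φ-preimage : ∀ {q} → p ≤ q → ρ q ℕ.≤ K → ∃ λ x → φ x ≡ q × ρ q ≡ ρ p ℕ.+ ρ x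
      φ-preimage {q} p≤q ρq≤K
        with r , chain ← saturatedChain p≤q ρq≤K
        with x , refl , back ← Φ.unmap-chain φ-up-closed
                                 (subst (λ a → SaturatedChain _≤_ a q r) (sym φ⊥≡p) chain) =
        x , refl , trans (chain-rank chain) (cong (ρ p ℕ.+_) (sym (ρ-from-⊥ back)))

module FiniteGraded {n : ℕ} (L : FiniteGradedLattice n) where

  open FiniteGradedLattice L public
  open IsLattice isLattice public using (isPartialOrder; antisym) renaming (refl to ≤-refl)
  open RankedPoset isPartialOrder isRank public

  saturatedChain-from-⊥ : ∀ x → ∃ (SaturatedChain _≤_ ⊥ x)
  saturatedChain-from-⊥ x =
    SaturatedChains.saturatedChain (ρ x) (λ a b _ → a ≤? b) (allFin n) (λ {y} _ → ∈-allFin y)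
                                   (⊥-min x) ℕP.≤-refl

  ρ≡0⇒≡⊥ : ∀ {x} → ρ x ≡ 0 → x ≡ ⊥
  ρ≡0⇒≡⊥ {x} ρx≡0 = decidable-stable (x Fin.≟ ⊥) λ x≢⊥ →
    ℕP.<⇒≢ (ρ-strict (⊥-min x) (x≢⊥ ∘ sym)) (trans ρ⊥≡0 (sym ρx≡0))

module Core {n : ℕ} (L : FiniteGradedLattice n) (U : UphoLattice) (t : UphoLattice.Carrier U)
            (t-join : IsJoinOfAtoms U t) (iso : IsoToCore U L t)
            (μ : Fin n → ℤ) (mobius : IsMobius L μ)
            (K : ℕ) (_≤?_ : Upho.DecidableUpToRank U K) where

  open Upho U
  open UpToRank K _≤?_

  module L = FiniteGraded L

  f : Fin n → Carrier
  f = proj₁ iso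

  f≤t : ∀ x → f x ≤ t
  f≤t = proj₁ (proj₂ iso)

  f-onto : ∀ y → y ≤ t → ∃ λ x → f x ≡ y
  f-onto = proj₁ (proj₂ (proj₂ iso))

  f-embedding : ∀ x y → x L.≤ y ⇔ f x ≤ f y
  f-embedding = proj₂ (proj₂ (proj₂ iso))

  f-convex : ∀ {x y z} → f x ≤ z → z ≤ f y → ∃ λ w → f w ≡ z
  f-convex {y = y} _ z≤fy = f-onto _ (≤-trans z≤fy (f≤t y))

  module F = OrderEmbedding L.isPartialOrder isPartialOrder f f-embedding

  f-⊥ : f L.⊥ ≡ ⊥
  f-⊥ = F.⊥↦min L.⊥-min (⊥-min ∘ f) (f-onto ⊥ (⊥-min t))

  ρ-f : ∀ x → ρ (f x) ≡ L.ρ x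
  ρ-f x with r , chain ← L.saturatedChain-from-⊥ x =
    trans (ρ-from-⊥ (subst (λ a → SaturatedChain _≤_ a (f x) r) f-⊥
                           (F.map-chain f-convex chain)))
          (sym (L.ρ-from-⊥ chain))

  coreOf : Carrier → Fin n
  coreOf q = proj₁ (f-onto (q ∧ t) (x∧y≤y q t))

  f-coreOf : ∀ q → f (coreOf q) ≡ q ∧ t
  f-coreOf q = proj₂ (f-onto (q ∧ t) (x∧y≤y q t))

  ≤-coreOf : ∀ {p q} → p L.≤ coreOf q ⇔ f p ≤ q
  ≤-coreOf {p} {q} = mk⇔
    (λ p≤ → ≤-trans (subst (f p ≤_) (f-coreOf q) (F.mono p≤)) (x∧y≤x q t))
    (λ fp≤q → F.cancel (subst (f p ≤_) (sym (f-coreOf q)) (∧-greatest fp≤q (f≤t p))))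

  coreOf-⊥ : coreOf ⊥ ≡ L.⊥
  coreOf-⊥ = F.injective (trans (f-coreOf ⊥) (trans (antisym (x∧y≤x ⊥ t) (⊥-min _)) (sym f-⊥)))

  atom≤⇒coreOf≢⊥ : ∀ {a q} → IsAtom U a → a ≤ q → coreOf q ≢ L.⊥
  atom≤⇒coreOf≢⊥ {a} {q} atom a≤q coreOf-q≡⊥ = proj₂ (proj₁ atom) (antisym (⊥-min a) a≤⊥)
    where
    a≤⊥ : a ≤ ⊥
    a≤⊥ = subst (a ≤_) (trans (sym (f-coreOf q)) (trans (cong f coreOf-q≡⊥) f-⊥))
                (∧-greatest a≤q (proj₁ t-join a atom))

  coreOf≡⊥⇒≡⊥ : ∀ {q} → ρ q ℕ.≤ K → coreOf q ≡ L.⊥ → q ≡ ⊥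
  coreOf≡⊥⇒≡⊥ {q} ρq≤K coreOf-q≡⊥ with saturatedChain (⊥-min q) ρq≤K
  ... | _ , []           = refl
  ... | _ , (atom ∷ as) = ⊥-elim (atom≤⇒coreOf≢⊥ atom (chain-≤ as) coreOf-q≡⊥)

  mobius-sum : ∀ x → ∑ (allFin n) (λ p → 𝟙 (p L.≤? x) * μ p) ≡ 𝟙 (x Fin.≟ L.⊥)
  mobius-sum x with x Fin.≟ L.⊥
  ... | yes refl = trans (∑-δ (λ p → p L.≤? L.⊥) μ (Unique.allFin⁺ n) (∈-allFin L.⊥) L.≤-refl
                              (λ p≤⊥ → L.antisym p≤⊥ (L.⊥-min _)))
                         (proj₁ mobius)
  ... | no  x≢⊥  = trans (sym (∑-filter (λ p → p L.≤? x) (allFin n) μ)) (proj₂ mobius x x≢⊥)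

  chiCoeff-0 : chiCoeff L μ 0 ≡ 1ℤ
  chiCoeff-0 = trans (∑-filter (λ p → L.ρ p ℕ.≟ 0) (allFin n) μ)
                     (trans (∑-δ (λ p → L.ρ p ℕ.≟ 0) μ (Unique.allFin⁺ n) (∈-allFin L.⊥)
                                 L.ρ⊥≡0 L.ρ≡0⇒≡⊥)
                            (proj₁ mobius))

  rankGF : ℕ → ℤ
  rankGF j = + rankCount j

  count-above-≤ : ∀ {m qs p} → m ℕ.≤ K → IsRankLevel m qs → L.ρ p ℕ.≤ m →
                  ∑ qs (λ q → 𝟙 (p L.≤? coreOf q)) ≡ rankGF (m ∸ L.ρ p)
  count-above-≤ {m} {qs} {p} m≤K level@(!qs , ∈qs) ρp≤m
    with ys , level′@(!ys , ∈ys) , count≡ ← rankCount-level (ℕP.≤-trans (ℕP.m∸n≤m m (L.ρ p)) m≤K) =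
    trans (count-by-bijection (λ q → p L.≤? coreOf q) φ !qs !ys Φ.injective into onto)
          (cong +_ (sym count≡))
    where
    open Filter (f p)
    into : ∀ {y} → y ∈ ys → φ y ∈ qs × p L.≤ coreOf (φ y)
    into {y} y∈ = Equivalence.from (∈qs (φ y)) ρφy≡m , Equivalence.from ≤-coreOf (p≤φ y)
      where
      open ≡-Reasoning
      ρφy≡m : ρ (φ y) ≡ m
      ρφy≡m = begin
        ρ (φ y)                 ≡⟨ ρ-φ (level-ρ≤K (ℕP.≤-trans (ℕP.m∸n≤m m (L.ρ p)) m≤K) level′ y∈) ⟩
        ρ (f p) ℕ.+ ρ y         ≡⟨ cong₂ ℕ._+_ (ρ-f p) (Equivalence.to (∈ys y) y∈) ⟩
        L.ρ p ℕ.+ (m ∸ L.ρ p)   ≡⟨ ℕP.m+[n∸m]≡n ρp≤m ⟩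
        m                       ∎
    onto : ∀ {q} → q ∈ qs → p L.≤ coreOf q → ∃ λ y → y ∈ ys × φ y ≡ q
    onto {q} q∈ p≤
      with x , φx≡q , ρq≡ ← φ-preimage (Equivalence.to ≤-coreOf p≤) (level-ρ≤K m≤K level q∈) =
      x , Equivalence.from (∈ys x) ρx≡m∸ρp , φx≡q
      where
      open ≡-Reasoning
      ρx≡m∸ρp : ρ x ≡ m ∸ L.ρ p
      ρx≡m∸ρp = begin
        ρ x                         ≡⟨ ℕP.m+n∸m≡n (ρ (f p)) (ρ x) ⟨
        ρ (f p) ℕ.+ ρ x ∸ ρ (f p)   ≡⟨ cong₂ _∸_ (trans (sym ρq≡) (Equivalence.to (∈qs q) q∈))
                                               (ρ-f p) ⟩
        m ∸ L.ρ p                   ∎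

  count-above-> : ∀ {m qs p} → IsRankLevel m qs → m ℕ.< L.ρ p →
                  ∑ qs (λ q → 𝟙 (p L.≤? coreOf q)) ≡ 0ℤ
  count-above-> {m} {qs} {p} (!qs , ∈qs) m<ρp =
    count-by-bijection (λ q → p L.≤? coreOf q) {ys = []} (λ q → q) !qs [] (λ e → e) (λ ())
      λ {q} q∈ p≤ → ⊥-elim (ℕP.<⇒≱ m<ρp (subst₂ ℕ._≤_ (ρ-f p) (Equivalence.to (∈qs q) q∈)
                                                (ρ-mono (Equivalence.to ≤-coreOf p≤))))

  count-above : ∀ {m qs} → m ℕ.≤ K → IsRankLevel m qs → ∀ p →
                ∑ qs (λ q → 𝟙 (p L.≤? coreOf q)) ≡ conv (monomial (L.ρ p)) rankGF m
  count-above {m} m≤K level p with L.ρ p ℕ.≤? m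
  ... | yes ρp≤m = trans (count-above-≤ m≤K level ρp≤m) (sym (conv-monomial-≤ rankGF ρp≤m))
  ... | no  ρp≰m = trans (count-above-> level m<ρp) (sym (conv-monomial-> rankGF m<ρp))
    where m<ρp = ℕP.≰⇒> ρp≰m

  count-bottom : ∀ {m qs} → m ℕ.≤ K → IsRankLevel m qs →
                 ∑ qs (λ q → 𝟙 (coreOf q Fin.≟ L.⊥)) ≡ one m
  count-bottom {zero} m≤K level@(!qs , ∈qs) =
    count-by-bijection (λ q → coreOf q Fin.≟ L.⊥) (λ q → q) !qs (All.[] ∷ []) (λ e → e)
      (λ { (here refl) → Equivalence.from (∈qs ⊥) ρ⊥≡0 , coreOf-⊥ })
      (λ q∈ core≡⊥ → ⊥ , here refl , sym (coreOf≡⊥⇒≡⊥ (level-ρ≤K m≤K level q∈) core≡⊥))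
  count-bottom {suc m} m≤K level@(!qs , ∈qs) =
    count-by-bijection (λ q → coreOf q Fin.≟ L.⊥) {ys = []} (λ q → q) !qs [] (λ e → e) (λ ())
      (λ {q} q∈ core≡⊥ → ⊥-elim (ℕP.0≢1+n (begin
        0       ≡⟨ ρ⊥≡0 ⟨
        ρ ⊥     ≡⟨ cong ρ (coreOf≡⊥⇒≡⊥ (level-ρ≤K m≤K level q∈) core≡⊥) ⟨
        ρ q     ≡⟨ Equivalence.to (∈qs q) q∈ ⟩
        suc m   ∎)))
    where open ≡-Reasoning

  chi*rankGF≡one : ∀ m → m ℕ.≤ K → conv (chiCoeff L μ) rankGF m ≡ one m
  chi*rankGF≡one m m≤K with qs , level , _ ← rankCount-level m≤K = begin
    conv (chiCoeff L μ) rankGF m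
      ≡⟨ conv-congˡ rankGF (λ j → ∑-filter (λ p → L.ρ p ℕ.≟ j) ps μ) m ⟩
    conv (λ j → ∑ ps (λ p → monomial (L.ρ p) j * μ p)) rankGF m
      ≡⟨ conv-∑ˡ ps (monomial ∘ L.ρ) μ rankGF m ⟩
    ∑ ps (λ p → conv (monomial (L.ρ p)) rankGF m * μ p)
      ≡⟨ ∑-cong ps (λ {p} _ → cong (_* μ p) (count-above m≤K level p)) ⟨
    ∑ ps (λ p → ∑ qs (λ q → 𝟙 (p L.≤? coreOf q)) * μ p)
      ≡⟨ ∑-cong ps (λ {p} _ → ∑-*ʳ qs (λ q → 𝟙 (p L.≤? coreOf q)) (μ p)) ⟨
    ∑ ps (λ p → ∑ qs (λ q → 𝟙 (p L.≤? coreOf q) * μ p))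
      ≡⟨ ∑-swap ps qs (λ p q → 𝟙 (p L.≤? coreOf q) * μ p) ⟩
    ∑ qs (λ q → ∑ ps (λ p → 𝟙 (p L.≤? coreOf q) * μ p))
      ≡⟨ ∑-cong qs (λ {q} _ → mobius-sum (coreOf q)) ⟩
    ∑ qs (λ q → 𝟙 (coreOf q Fin.≟ L.⊥))
      ≡⟨ count-bottom m≤K level ⟩
    one m ∎
    where
    open ≡-Reasoning
    ps = allFin n

lemma5p1 : {n : ℕ} (L : FiniteGradedLattice n) (U : UphoLattice)
           (t : UphoLattice.Carrier U) → IsJoinOfAtoms U t → IsoToCore U L t →
           (μ : Fin n → ℤ) → IsMobius L μ →
           (b : ℕ → ℤ) → IsInverse (chiCoeff L μ) b →
           ∀ k → 0ℤ ℤ.≤ b k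
lemma5p1 L U t t-join iso μ mobius b inverse k =
  decidable-stable (0ℤ ℤ.≤? b k) (¬¬-map b-nonneg (Upho.¬¬-decidableUpToRank U k))
  where
  b-nonneg : Upho.DecidableUpToRank U k → 0ℤ ℤ.≤ b k
  b-nonneg _≤?_ = subst (0ℤ ℤ.≤_) (sym b≡rankGF) (+≤+ z≤n)
    where
    open Core L U t t-join iso μ mobius k _≤?_
    b≡rankGF : b k ≡ rankGF k
    b≡rankGF = conv-cancelˡ {a = chiCoeff L μ} {b} {rankGF} chiCoeff-0
                 (λ m m≤k → trans (inverse m) (sym (chi*rankGF≡one m m≤k))) k ℕP.≤-refl
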